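{- For every $n\ge 3$, the Sprague-Grundy value of Grim on the cycle $C_n$ satisfies $\mathcal{SG}(C_n)=1$ if $\mathcal{SG}(P_{n-1})=0$, and $\mathcal{SG}(C_n)=0$ otherwise. In particular, $C_n$ is a $\mathcal{P}$ position when $n$ is even.
   Context: Grim: two players alternate moves on a finite simple undirected graph; isolated vertices are deleted before play; a move chooses a remaining vertex and deletes it with its incident edges, then deletes all vertices that have become isolated; the last player to move wins. $P_m$ and $C_m$ denote the path and cycle on $m$ vertices. The Sprague-Grundy value of a graph $G$ is $\mathcal{SG}(G)=\mathrm{mex}\{\mathcal{SG}(H): H \text{ obtainable from } G \text{ by one move}\}$, mex being the least non-negative integer not in the set. A graph is a $\mathcal{P}$ position (the player to move has no winning strategy) iff its Sprague-Grundy value is $0$, and an $\mathcal{N}$ position otherwise. -}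

module Defs where

open import Data.Nat using (ℕ; zero; suc; _∸_; _≡ᵇ_)
open import Data.Bool using (Bool; true; false; _∧_; _∨_; not; if_then_else_)
open import Data.Fin using (Fin; toℕ)
open import Data.List using (List; []; _∷_; length; map; filter; allFin)
open import Data.Bool.ListAction using (any)

-- A (finite, simple, undirected) graph on vertex set Fin n, given by its
-- Boolean adjacency relation.  (All graphs used below are symmetric and
-- irreflexive.)
Graph : ℕ → Set
Graph n = Fin n → Fin n → Bool

VSet : ℕ → Set
VSet n = Fin n → Bool

elemᵇ : ℕ → List ℕ → Bool
elemᵇ m [] = false
elemᵇ m (x ∷ xs) = (m ≡ᵇ x) ∨ elemᵇ m xs

mexFrom : List ℕ → ℕ → ℕ → ℕ
mexFrom xs zero    m = m
mexFrom xs (suc k) m = if elemᵇ m xs then mexFrom xs k (suc m) else m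

-- mex xs ≤ length xs, so length xs + 1 search steps suffice.
mex : List ℕ → ℕ
mex xs = mexFrom xs (suc (length xs)) 0

module _ {n : ℕ} (G : Graph n) where

  removeIsolated : VSet n → VSet n
  removeIsolated S u = S u ∧ any (λ w → S w ∧ G u w) (allFin n)

  deleteV : Fin n → VSet n → VSet n
  deleteV v S u = if toℕ u ≡ᵇ toℕ v then false else S u

  move : Fin n → VSet n → VSet n
  move v S = removeIsolated (deleteV v S)

  -- Every move removes at least one vertex, so any k ≥ |S| gives
  -- the true value (at depth 0 the only position reached is the empty one).
  sgBounded : ℕ → VSet n → ℕ
  sgBounded zero    S = 0
  sgBounded (suc k) S =
    mex (map (λ v → sgBounded k (move v S)) (filter (λ v → S v Data.Bool.≟ true) (allFin n)))

  SG : ℕ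
  SG = sgBounded n (removeIsolated (λ _ → true))

P : (m : ℕ) → Graph m
P m i j = (suc (toℕ i) ≡ᵇ toℕ j) ∨ (suc (toℕ j) ≡ᵇ toℕ i)

C : (m : ℕ) → Graph m
C m i j = P m i j
        ∨ ((toℕ i ≡ᵇ 0) ∧ (toℕ j ≡ᵇ (m ∸ 1)))
        ∨ ((toℕ j ≡ᵇ 0) ∧ (toℕ i ≡ᵇ (m ∸ 1)))

-- Deleting any vertex of the cycle C n leaves a copy of the path P (n - 1): the cyclic
-- rotation is an automorphism of C n, so all options of C n have the same value, and
-- the option at the last vertex is P (n - 1) via the inclusion Fin (n - 1) → Fin n.
-- Hence SG (C n) = mex {SG (P (n - 1))}.  For n even, P (n - 1) has an odd number
-- 2k + 1 of vertices.  The first player deletes the middle vertex and then answers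
-- every move u by the mirror vertex 2k - u (Tweedledum and Tweedledee).  No vertex
-- is adjacent to its mirror image, so the answer is always legal and the position
-- stays symmetric; the position after the first move is therefore a P position,
-- and SG (P (n - 1)) ≠ 0.
module Submission where

open import Defs
open import Data.Bool using (true; false; T; _∧_; _∨_)
import Data.Bool as Bool
open import Data.Bool.Properties using (T-∧; T-∨; T-≡; ∨-comm; ∨-identityʳ; ∨-zeroʳ; ∧-zeroʳ)
open import Data.Empty using (⊥-elim)
open import Data.Fin using (Fin; zero; suc; toℕ; fromℕ; fromℕ<; inject₁; lower₁; opposite)
open import Data.Fin.Induction using (>-weakInduction)
open import Data.Fin.Properties
  using (toℕ-injective; toℕ<n; toℕ-fromℕ; toℕ-fromℕ<; toℕ-inject₁; inject₁-injective; inject₁-lower₁;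
         fromℕ≢inject₁; opposite-prop; opposite-involutive; pigeonhole)
open import Data.Fin.Subset using () renaming (_∈_ to _∈ₛ_; ∣_∣ to ∣_∣ₛ)
open import Data.Fin.Subset.Properties using (p⊂q⇒∣p∣<∣q∣; ∣p∣≤n)
open import Data.List using (List; _∷_; [_]; length; lookup; map; filter; allFin)
open import Data.List.Membership.Propositional using (_∈_; _∉_; lose)
open import Data.List.Membership.Propositional.Properties using (∈-map⁺; ∈-map⁻; ∈-filter⁺; ∈-filter⁻; ∈-allFin)
open import Data.List.Relation.Binary.Subset.Propositional using (_⊆_)
open import Data.List.Relation.Unary.Any using (here; there; index; satisfied)
open import Data.List.Relation.Unary.Any.Properties using (lookup-index; any⁺; any⁻)
open import Data.Nat using (ℕ; zero; suc; _+_; _*_; _∸_; _≤_; _<_; z≤n; z<s; s≤s; _≡ᵇ_)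
open import Data.Nat.Divisibility using (_∣_; divides)
open import Data.Nat.Properties
  using (≡ᵇ⇒≡; ≡⇒≡ᵇ; _≟_; _≤?_; <-cmp; <⇒≢; >⇒≢; <⇒≤; <⇒≱; ≰⇒>; ≤∧≢⇒<; 1+n≰n; 1+n≢n; n≮0;
         ≤-pred; ≤-trans; +-identityʳ; +-suc; *-comm; suc-injective; m∸n+n≡m; m+n∸n≡m; m≤m+n)
open import Data.Product using (∃; _×_; _,_; proj₁; proj₂)
open import Data.Sum using (_⊎_; inj₁; inj₂)
import Data.Sum as Sum
open import Data.Unit using (tt)
open import Data.Vec using (tabulate)
open import Data.Vec.Properties using (lookup∘tabulate; lookup⇒[]=; []=⇒lookup)
open import Function.Base using (_∘_)
open import Function.Bundles using (module Equivalence)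
open import Relation.Binary.Definitions using (tri<; tri≈; tri>)
open import Relation.Binary.PropositionalEquality
  using (_≡_; _≢_; refl; sym; trans; cong; cong₂; subst; subst₂; module ≡-Reasoning)
open import Relation.Nullary using (¬_; yes; no)

T-ext : ∀ {a b} → (T a → T b) → (T b → T a) → a ≡ b
T-ext {false} {false} _ _ = refl
T-ext {false} {true}  _ b⇒a = ⊥-elim (b⇒a _)
T-ext {true}  {false} a⇒b _ = ⊥-elim (a⇒b _)
T-ext {true}  {true}  _ _ = refl

≡ᵇ-refl : ∀ a → (a ≡ᵇ a) ≡ true
≡ᵇ-refl a = Equivalence.to T-≡ (≡⇒≡ᵇ a a refl)

≢⇒≡ᵇ-false : ∀ {a b} → a ≢ b → (a ≡ᵇ b) ≡ false
≢⇒≡ᵇ-false {a} {b} a≢b with a ≡ᵇ b | ≡ᵇ⇒≡ a b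
... | false | _ = refl
... | true | a≡b = ⊥-elim (a≢b (a≡b _))

-- Minimum excludant

elemᵇ⁺ : ∀ {m xs} → m ∈ xs → T (elemᵇ m xs)
elemᵇ⁺ {m} {x ∷ xs} (here refl) = Equivalence.from (T-∨ {m ≡ᵇ m}) (inj₁ (≡⇒≡ᵇ m m refl))
elemᵇ⁺ {m} {x ∷ xs} (there m∈xs) = Equivalence.from (T-∨ {m ≡ᵇ x}) (inj₂ (elemᵇ⁺ m∈xs))

elemᵇ⁻ : ∀ m xs → T (elemᵇ m xs) → m ∈ xs
elemᵇ⁻ m (x ∷ xs) t with Equivalence.to (T-∨ {m ≡ᵇ x}) t
... | inj₁ m≡x = here (≡ᵇ⇒≡ m x m≡x)
... | inj₂ m∈xs = there (elemᵇ⁻ m xs m∈xs)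

mexFrom-below : ∀ xs k {m j} → m ≤ j → j < mexFrom xs k m → j ∈ xs
mexFrom-below xs zero m≤j j<m = ⊥-elim (<⇒≱ j<m m≤j)
mexFrom-below xs (suc k) {m} {j} m≤j j<mex with elemᵇ m xs in m∈?xs
... | false = ⊥-elim (<⇒≱ j<mex m≤j)
... | true with m ≟ j
...   | yes refl = elemᵇ⁻ m xs (subst T (sym m∈?xs) _)
...   | no m≢j = mexFrom-below xs k (≤∧≢⇒< m≤j m≢j) j<mex

mexFrom-exhausted : ∀ xs k m → mexFrom xs k m ∈ xs → mexFrom xs k m ≡ m + k
mexFrom-exhausted xs zero m _ = sym (+-identityʳ m)
mexFrom-exhausted xs (suc k) m found with elemᵇ m xs in m∈?xs
... | false = ⊥-elim (subst T m∈?xs (elemᵇ⁺ found))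
... | true = trans (mexFrom-exhausted xs k (suc m) found) (sym (+-suc m k))

initial-segment⊆⇒≤length : ∀ N xs → (∀ {j} → j < N → j ∈ xs) → N ≤ length xs
initial-segment⊆⇒≤length N xs below with N ≤? length xs
... | yes N≤len = N≤len
... | no N≰len = let i , j , i<j , same = pigeonhole (≰⇒> N≰len) position in
  ⊥-elim (<⇒≢ i<j (begin
    toℕ i                   ≡⟨ lookup-index (below (toℕ<n i)) ⟩
    lookup xs (position i)  ≡⟨ cong (lookup xs) same ⟩
    lookup xs (position j)  ≡⟨ sym (lookup-index (below (toℕ<n j))) ⟩
    toℕ j                   ∎))
  where
  open ≡-Reasoning
  position : Fin N → Fin (length xs)
  position i = index (below (toℕ<n i))

mex-∉ : ∀ xs → mex xs ∉ xs
mex-∉ xs mex∈xs = 1+n≰n (initial-segment⊆⇒≤length (suc (length xs)) xs (λ {j} j<N →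
  mexFrom-below xs (suc (length xs)) z≤n (subst (j <_) (sym (mexFrom-exhausted xs _ 0 mex∈xs)) j<N)))

mex-minimal : ∀ xs {j} → j < mex xs → j ∈ xs
mex-minimal xs = mexFrom-below xs (suc (length xs)) z≤n

mex-cong : ∀ {xs ys} → xs ⊆ ys → ys ⊆ xs → mex xs ≡ mex ys
mex-cong {xs} {ys} xs⊆ys ys⊆xs with <-cmp (mex xs) (mex ys)
... | tri< lt _ _ = ⊥-elim (mex-∉ xs (ys⊆xs (mex-minimal ys lt)))
... | tri≈ _ eq _ = eq
... | tri> _ _ gt = ⊥-elim (mex-∉ ys (xs⊆ys (mex-minimal xs gt)))

mex≡0 : ∀ xs → 0 ∉ xs → mex xs ≡ 0
mex≡0 xs 0∉xs with mex xs in eq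
... | zero = refl
... | suc _ = ⊥-elim (0∉xs (mex-minimal xs (subst (0 <_) (sym eq) z<s)))

mex≢0 : ∀ xs → 0 ∈ xs → mex xs ≢ 0
mex≢0 xs 0∈xs mex≡0 = mex-∉ xs (subst (_∈ xs) (sym mex≡0) 0∈xs)

-- Grim moves

module _ {n : ℕ} (G : Graph n) where

  HasNeighbourIn : VSet n → Fin n → Set
  HasNeighbourIn S u = ∃ λ w → T (S w) × T (G u w)

  removeIsolated⁻ : ∀ S {u} → T (removeIsolated G S u) → T (S u) × HasNeighbourIn S u
  removeIsolated⁻ S {u} t with Equivalence.to (T-∧ {S u}) t
  ... | live , hasNeighbour with satisfied (any⁻ (λ w → S w ∧ G u w) (allFin n) hasNeighbour)
  ...   | w , adjacentLive = live , w , Equivalence.to (T-∧ {S w}) adjacentLive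

  removeIsolated⁺ : ∀ S {u} → T (S u) → HasNeighbourIn S u → T (removeIsolated G S u)
  removeIsolated⁺ S {u} live (w , wLive , uw) = Equivalence.from (T-∧ {S u}) (live ,
    any⁺ (λ w → S w ∧ G u w) (lose (∈-allFin w) (Equivalence.from (T-∧ {S w}) (wLive , uw))))

  Remains : Fin n → VSet n → Fin n → Set
  Remains v S u = T (S u) × u ≢ v

  deleteV⁻ : ∀ v S {u} → T (deleteV G v S u) → Remains v S u
  deleteV⁻ v S {u} t with toℕ u ≡ᵇ toℕ v in u≟v
  ... | false = t , λ { refl → subst T u≟v (≡⇒≡ᵇ (toℕ u) (toℕ u) refl) }

  deleteV⁺ : ∀ v S {u} → Remains v S u → T (deleteV G v S u)
  deleteV⁺ v S {u} (live , u≢v) with toℕ u ≡ᵇ toℕ v in u≟v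
  ... | false = live
  ... | true = u≢v (toℕ-injective (≡ᵇ⇒≡ (toℕ u) (toℕ v) (subst T (sym u≟v) _)))

  move⁻ : ∀ v S {u} → T (move G v S u) → Remains v S u × ∃ λ w → Remains v S w × T (G u w)
  move⁻ v S t with removeIsolated⁻ (deleteV G v S) t
  ... | remains , w , wRemains , uw = deleteV⁻ v S remains , w , deleteV⁻ v S wRemains , uw

  move⁺ : ∀ v S {u w} → Remains v S u → Remains v S w → T (G u w) → T (move G v S u)
  move⁺ v S uRemains wRemains uw =
    removeIsolated⁺ (deleteV G v S) (deleteV⁺ v S uRemains) (_ , deleteV⁺ v S wRemains , uw)

  move-⊆ : ∀ v S {u} → T (move G v S u) → T (S u)
  move-⊆ v S t = proj₁ (proj₁ (move⁻ v S t))

  move-removes : ∀ v S → ¬ T (move G v S v)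
  move-removes v S t = proj₂ (proj₁ (move⁻ v S t)) refl

  options : ℕ → VSet n → List ℕ
  options k S = map (λ v → sgBounded G k (move G v S)) (filter (λ v → S v Bool.≟ true) (allFin n))

  option⁺ : ∀ k S v → T (S v) → sgBounded G k (move G v S) ∈ options k S
  option⁺ k S v live = ∈-map⁺ (λ v → sgBounded G k (move G v S))
    (∈-filter⁺ (λ v → S v Bool.≟ true) (∈-allFin v) (Equivalence.to T-≡ live))

  option⁻ : ∀ k S {x} → x ∈ options k S → ∃ λ v → T (S v) × x ≡ sgBounded G k (move G v S)
  option⁻ k S x∈ with ∈-map⁻ (λ v → sgBounded G k (move G v S)) x∈
  ... | v , v∈ , x≡ =
    v , Equivalence.from T-≡ (proj₂ (∈-filter⁻ (λ v → S v Bool.≟ true) {xs = allFin n} v∈)) , x≡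

size : ∀ {n} → VSet n → ℕ
size S = ∣ tabulate S ∣ₛ

size≤ : ∀ {n} (S : VSet n) → size S ≤ n
size≤ S = ∣p∣≤n (tabulate S)

∈-tabulate⁺ : ∀ {n} (S : VSet n) {u} → T (S u) → u ∈ₛ tabulate S
∈-tabulate⁺ S {u} live = lookup⇒[]= u (tabulate S) (trans (lookup∘tabulate S u) (Equivalence.to T-≡ live))

∈-tabulate⁻ : ∀ {n} (S : VSet n) {u} → u ∈ₛ tabulate S → T (S u)
∈-tabulate⁻ S {u} u∈ = Equivalence.from T-≡ (trans (sym (lookup∘tabulate S u)) ([]=⇒lookup u∈))

size-< : ∀ {n} (S S' : VSet n) {v} → (∀ {u} → T (S' u) → T (S u)) → T (S v) → ¬ T (S' v) → size S' < size S
size-< S S' S'⊆S vLive v∉S' = p⊂q⇒∣p∣<∣q∣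
  ( (λ u∈ → ∈-tabulate⁺ S (S'⊆S (∈-tabulate⁻ S' u∈)))
  , _ , ∈-tabulate⁺ S vLive , λ v∈ → v∉S' (∈-tabulate⁻ S' v∈))

size-move : ∀ {n} (G : Graph n) v S → T (S v) → size (move G v S) < size S
size-move G v S vLive = size-< S (move G v S) (move-⊆ G v S) vLive (move-removes G v S)

initial : ∀ {n} → Graph n → VSet n
initial G = removeIsolated G (λ _ → true)

initial-live : ∀ {n} (G : Graph n) u → (∃ λ w → T (G u w)) → T (initial G u)
initial-live G u (w , uw) = removeIsolated⁺ G (λ _ → true) {u} _ (w , _ , uw)

-- Transporting positions along graph embeddings

record IsImageOf {n m} (f : Fin m → Fin n) (X : VSet n) (Y : VSet m) : Set where
  field
    along : ∀ w → X (f w) ≡ Y w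
    onto  : ∀ {u} → T (X u) → ∃ λ w → f w ≡ u

module _ {n m} {G : Graph n} {H : Graph m} {f : Fin m → Fin n}
         (f-injective : ∀ {w w'} → f w ≡ f w' → w ≡ w')
         (f-adj : ∀ w w' → G (f w) (f w') ≡ H w w') where

  move-image : ∀ {X Y} → IsImageOf f X Y → ∀ w → IsImageOf f (move G (f w) X) (move H w Y)
  move-image {X} {Y} image w = record
    { along = λ w' → T-ext (forward w') (backward w')
    ; onto  = λ live → onto (move-⊆ G (f w) X live) }
    where
    open IsImageOf image
    forward : ∀ w' → T (move G (f w) X (f w')) → T (move H w Y w')
    forward w' t with move⁻ G (f w) X t
    ... | (w'Live , w'≢w) , x , (xLive , x≢w) , adj with onto xLive
    ...   | x' , refl = move⁺ H w Y
            (subst T (along w') w'Live , w'≢w ∘ cong f)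
            (subst T (along x') xLive , x≢w ∘ cong f)
            (subst T (f-adj w' x') adj)
    backward : ∀ w' → T (move H w Y w') → T (move G (f w) X (f w'))
    backward w' t with move⁻ H w Y t
    ... | (w'Live , w'≢w) , x , (xLive , x≢w) , adj = move⁺ G (f w) X
            (subst T (sym (along w')) w'Live , w'≢w ∘ f-injective)
            (subst T (sym (along x)) xLive , x≢w ∘ f-injective)
            (subst T (sym (f-adj w' x)) adj)

  sgBounded-image : ∀ {X Y} → IsImageOf f X Y → ∀ k → sgBounded G k X ≡ sgBounded H k Y
  sgBounded-image image zero = refl
  sgBounded-image {X} {Y} image (suc k) = mex-cong forward backward
    where
    open IsImageOf image
    same-option : ∀ w → sgBounded G k (move G (f w) X) ≡ sgBounded H k (move H w Y)
    same-option w = sgBounded-image (move-image image w) k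
    forward : ∀ {x} → x ∈ options G k X → x ∈ options H k Y
    forward x∈ with option⁻ G k X x∈
    ... | v , vLive , refl with onto vLive
    ...   | w , refl = subst (_∈ options H k Y) (sym (same-option w)) (option⁺ H k Y w (subst T (along w) vLive))
    backward : ∀ {x} → x ∈ options H k Y → x ∈ options G k X
    backward x∈ with option⁻ H k Y x∈
    ... | w , wLive , refl = subst (_∈ options G k X) (same-option w) (option⁺ G k X (f w) (subst T (sym (along w)) wLive))

Undirected : ∀ {n} → Graph n → Set
Undirected G = ∀ u w → G u w ≡ G w u

module _ {n} {G : Graph n} (undirected : Undirected G) where

  move-hasNeighbour : ∀ v S {u} → T (move G v S u) → HasNeighbourIn G (move G v S) u
  move-hasNeighbour v S t with move⁻ G v S t
  ... | uRemains , w , wRemains , uw = w , move⁺ G v S wRemains uRemains (subst T (undirected _ w) uw) , uw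

  RemainsBoth : Fin n → Fin n → VSet n → Fin n → Set
  RemainsBoth a b S u = T (S u) × u ≢ a × u ≢ b

  move²⁻ : ∀ a b S {u} → T (move G a (move G b S) u) →
    RemainsBoth a b S u × ∃ λ w → RemainsBoth a b S w × T (G u w)
  move²⁻ a b S t with move⁻ G a (move G b S) t
  ... | (uLive , u≢a) , w , (wLive , w≢a) , uw with move⁻ G b S uLive | move⁻ G b S wLive
  ...   | (u∈S , u≢b) , _ | (w∈S , w≢b) , _ = (u∈S , u≢a , u≢b) , w , (w∈S , w≢a , w≢b) , uw

  move²⁺ : ∀ a b S {u w} → RemainsBoth a b S u → RemainsBoth a b S w → T (G u w) →
    T (move G a (move G b S) u)
  move²⁺ a b S {u} {w} (u∈S , u≢a , u≢b) (w∈S , w≢a , w≢b) uw = move⁺ G a (move G b S)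
    (move⁺ G b S (u∈S , u≢b) (w∈S , w≢b) uw , u≢a)
    (move⁺ G b S (w∈S , w≢b) (u∈S , u≢b) (subst T (undirected u w) uw) , w≢a)
    uw

  move-comm : ∀ a b S u → move G a (move G b S) u ≡ move G b (move G a S) u
  move-comm a b S u = T-ext (swap a b) (swap b a)
    where
    swap : ∀ a b → T (move G a (move G b S) u) → T (move G b (move G a S) u)
    swap a b t with move²⁻ a b S t
    ... | (u∈S , u≢a , u≢b) , w , (w∈S , w≢a , w≢b) , uw =
      move²⁺ b a S (u∈S , u≢b , u≢a) (w∈S , w≢b , w≢a) uw

-- The mirror strategy

module MirrorStrategy {n} (G : Graph n) (undirected : Undirected G) (σ : Fin n → Fin n)
  (σ-involutive : ∀ u → σ (σ u) ≡ u)
  (σ-adj : ∀ u w → G (σ u) (σ w) ≡ G u w)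
  (σ-nonadjacent : ∀ u → ¬ T (G u (σ u))) where

  σ-injective : ∀ {u w} → σ u ≡ σ w → u ≡ w
  σ-injective {u} {w} σu≡σw = trans (sym (σ-involutive u)) (trans (cong σ σu≡σw) (σ-involutive w))

  record IsSymmetric (S : VSet n) : Set where
    field
      symmetric     : ∀ u → S (σ u) ≡ S u
      fixpoint-free : ∀ {u} → T (S u) → σ u ≢ u
      no-isolated   : ∀ {u} → T (S u) → HasNeighbourIn G S u

  σ-image : ∀ {S} → (∀ u → S (σ u) ≡ S u) → IsImageOf σ S S
  σ-image symmetric = record { along = symmetric ; onto = λ {u} _ → σ u , σ-involutive u }

  σ-move-image : ∀ {X Y} → IsImageOf σ X Y → ∀ w → IsImageOf σ (move G (σ w) X) (move G w Y)
  σ-move-image = move-image {G = G} {H = G} σ-injective σ-adj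

  module _ {S} (S-symmetric : IsSymmetric S) {v} (vLive : T (S v)) where
    open IsSymmetric S-symmetric

    Reply : VSet n
    Reply = move G (σ v) (move G v S)

    reply-legal : T (move G v S (σ v))
    reply-legal with no-isolated vLive
    ... | w , wLive , vw = move⁺ G v S
      (subst T (sym (symmetric v)) vLive , fixpoint-free vLive)
      (subst T (sym (symmetric w)) wLive , σw≢v)
      (subst T (sym (σ-adj v w)) vw)
      where
      σw≢v : σ w ≢ v
      σw≢v σw≡v = σ-nonadjacent w (subst T (undirected (σ w) w) (subst (λ x → T (G x w)) (sym σw≡v) vw))

    reply-symmetric : ∀ u → Reply (σ u) ≡ Reply u
    reply-symmetric u = begin
      move G (σ v) (move G v S) (σ u)          ≡⟨ move-comm undirected (σ v) v S (σ u) ⟩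
      move G v (move G (σ v) S) (σ u)
        ≡⟨ cong (λ x → move G x (move G (σ v) S) (σ u)) (sym (σ-involutive v)) ⟩
      move G (σ (σ v)) (move G (σ v) S) (σ u)
        ≡⟨ IsImageOf.along (σ-move-image (σ-move-image (σ-image symmetric) v) (σ v)) u ⟩
      move G (σ v) (move G v S) u              ∎
      where open ≡-Reasoning

    reply-isSymmetric : IsSymmetric Reply
    reply-isSymmetric = record
      { symmetric = reply-symmetric
      ; fixpoint-free = fixpoint-free ∘ move-⊆ G v S ∘ move-⊆ G (σ v) (move G v S)
      ; no-isolated = move-hasNeighbour undirected (σ v) (move G v S) }

  mutual
    sgBounded-symmetric : ∀ k {S} → IsSymmetric S → size S ≤ k → sgBounded G k S ≡ 0
    sgBounded-symmetric zero _ _ = refl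
    sgBounded-symmetric (suc k) {S} S-symmetric size≤ = mex≡0 (options G k S) 0∉options
      where
      0∉options : 0 ∉ options G k S
      0∉options 0∈ with option⁻ G k S 0∈
      ... | v , vLive , 0≡ =
        sgBounded-move≢0 k S-symmetric vLive (≤-pred (≤-trans (size-move G v S vLive) size≤)) (sym 0≡)

    sgBounded-move≢0 : ∀ k {S} (S-symmetric : IsSymmetric S) {v} (vLive : T (S v)) →
      size (move G v S) ≤ k → sgBounded G k (move G v S) ≢ 0
    sgBounded-move≢0 zero S-symmetric vLive size≤ =
      ⊥-elim (n≮0 (≤-trans (size-move G _ _ (reply-legal S-symmetric vLive)) size≤))
    sgBounded-move≢0 (suc k) {S} S-symmetric {v} vLive size≤ = mex≢0 (options G k (move G v S))
      (subst (_∈ options G k (move G v S))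
        (sgBounded-symmetric k (reply-isSymmetric S-symmetric vLive)
          (≤-pred (≤-trans (size-move G (σ v) (move G v S) (reply-legal S-symmetric vLive)) size≤)))
        (option⁺ G k (move G v S) (σ v) (reply-legal S-symmetric vLive)))

-- Cycles

cyclicPred : ∀ {m} → Fin (suc m) → Fin (suc m)
cyclicPred {m} zero = fromℕ m
cyclicPred (suc i) = inject₁ i

cyclicPred-injective : ∀ {m} {u w : Fin (suc m)} → cyclicPred u ≡ cyclicPred w → u ≡ w
cyclicPred-injective {u = zero}  {zero}  _ = refl
cyclicPred-injective {u = zero}  {suc j} eq = ⊥-elim (fromℕ≢inject₁ eq)
cyclicPred-injective {u = suc i} {zero}  eq = ⊥-elim (fromℕ≢inject₁ (sym eq))
cyclicPred-injective {u = suc i} {suc j} eq = cong suc (inject₁-injective eq)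

cyclicPred-onto : ∀ {m} (u : Fin (suc m)) → ∃ λ w → cyclicPred w ≡ u
cyclicPred-onto {m} u with m ≟ toℕ u
... | yes m≡u = zero , toℕ-injective (trans (toℕ-fromℕ m) m≡u)
... | no m≢u = suc (lower₁ u m≢u) , inject₁-lower₁ u m≢u

C-undirected : ∀ n → Undirected (C n)
C-undirected n u w = cong₂ _∨_ (∨-comm (suc (toℕ u) ≡ᵇ toℕ w) _) (∨-comm ((toℕ u ≡ᵇ 0) ∧ _) _)

C-suc-suc : ∀ m (i j : Fin m) → C (suc m) (suc i) (suc j) ≡ P m i j
C-suc-suc m i j = ∨-identityʳ (P m i j)

C-inject₁ : ∀ m (i j : Fin m) → C (suc m) (inject₁ i) (inject₁ j) ≡ P m i j
C-inject₁ m i j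
  rewrite toℕ-inject₁ i | toℕ-inject₁ j
        | ≢⇒≡ᵇ-false (<⇒≢ (toℕ<n i)) | ≢⇒≡ᵇ-false (<⇒≢ (toℕ<n j))
        | ∧-zeroʳ (toℕ i ≡ᵇ 0) | ∧-zeroʳ (toℕ j ≡ᵇ 0) = ∨-identityʳ (P m i j)

C-last-inject₁ : ∀ m (j : Fin m) → C (suc m) (fromℕ m) (inject₁ j) ≡ C (suc m) zero (suc j)
C-last-inject₁ (suc m) zero rewrite toℕ-fromℕ m | ≡ᵇ-refl m = ∨-zeroʳ (0 ≡ᵇ m)
C-last-inject₁ (suc m) (suc j)
  rewrite toℕ-fromℕ m | toℕ-inject₁ j | ≢⇒≡ᵇ-false (>⇒≢ (s≤s (<⇒≤ (toℕ<n j)))) = refl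

C-last-last : ∀ m → C (suc m) (fromℕ m) (fromℕ m) ≡ C (suc m) zero zero
C-last-last zero = refl
C-last-last (suc m) rewrite ≢⇒≡ᵇ-false (1+n≢n {toℕ (fromℕ m)}) = refl

C-cyclicPred : ∀ m u w → C (suc m) (cyclicPred u) (cyclicPred w) ≡ C (suc m) u w
C-cyclicPred m zero    zero    = C-last-last m
C-cyclicPred m zero    (suc j) = C-last-inject₁ m j
C-cyclicPred m (suc i) zero    = trans (C-undirected (suc m) (inject₁ i) (fromℕ m))
  (trans (C-last-inject₁ m i) (C-undirected (suc m) zero (suc i)))
C-cyclicPred m (suc i) (suc j) = trans (C-inject₁ m i j) (sym (C-suc-suc m i j))

P-suc-inject₁ : ∀ {m} (i : Fin m) → T (P (suc m) (suc i) (inject₁ i))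
P-suc-inject₁ i rewrite toℕ-inject₁ i | ≡ᵇ-refl (toℕ i) | ∨-zeroʳ (suc (suc (toℕ i)) ≡ᵇ toℕ i) = tt

P-neighbour : ∀ j (w : Fin (suc (suc j))) → ∃ λ w' → T (P (suc (suc j)) w w')
P-neighbour j zero = suc zero , tt
P-neighbour j (suc i) = inject₁ i , P-suc-inject₁ i

C-adjacent-cyclicPred : ∀ m u → T (C (suc m) u (cyclicPred u))
C-adjacent-cyclicPred m zero rewrite toℕ-fromℕ m | ≡ᵇ-refl m | ∨-zeroʳ ((1 ≡ᵇ m) ∨ false) = tt
C-adjacent-cyclicPred m (suc i) = Equivalence.from (T-∨ {P (suc m) (suc i) (inject₁ i)}) (inj₁ (P-suc-inject₁ i))

C-initial-live : ∀ m u → T (initial (C (suc m)) u)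
C-initial-live m u = initial-live (C (suc m)) u (cyclicPred u , C-adjacent-cyclicPred m u)

module CycleOptions (j : ℕ) where
  m n : ℕ
  m = suc (suc j)
  n = suc m

  start : VSet n
  start = initial (C n)

  start-rotation : IsImageOf cyclicPred start start
  start-rotation = record
    { along = λ w → T-ext (λ _ → C-initial-live m w) (λ _ → C-initial-live m (cyclicPred w))
    ; onto  = λ {u} _ → cyclicPred-onto u }

  option-rotation : ∀ v →
    sgBounded (C n) m (move (C n) (cyclicPred v) start) ≡ sgBounded (C n) m (move (C n) v start)
  option-rotation v = sgBounded-image cyclicPred-injective (C-cyclicPred m)
    (move-image cyclicPred-injective (C-cyclicPred m) start-rotation v) m

  last-removed : IsImageOf inject₁ (move (C n) (fromℕ m) start) (initial (P m))
  last-removed = record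
    { along = λ w → T-ext (λ _ → initial-live (P m) w (P-neighbour j w)) (λ _ → remains w)
    ; onto  = below-last }
    where
    below-last : ∀ {u} → T (move (C n) (fromℕ m) start u) → ∃ λ w → inject₁ w ≡ u
    below-last {u} live = lower₁ u m≢u , inject₁-lower₁ u m≢u
      where
      m≢u : m ≢ toℕ u
      m≢u m≡u = proj₂ (proj₁ (move⁻ (C n) (fromℕ m) start live))
        (toℕ-injective (trans (sym m≡u) (sym (toℕ-fromℕ m))))
    remains : ∀ w → T (move (C n) (fromℕ m) start (inject₁ w))
    remains w with P-neighbour j w
    ... | w' , ww' = move⁺ (C n) (fromℕ m) start {inject₁ w} {inject₁ w'}
      (C-initial-live m (inject₁ w) , fromℕ≢inject₁ ∘ sym)
      (C-initial-live m (inject₁ w') , fromℕ≢inject₁ ∘ sym)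
      (subst T (sym (C-inject₁ m w w')) ww')

  -- Induction downwards from the last vertex, using cyclicPred (suc i) = inject₁ i.
  option≡SG-path : ∀ v → sgBounded (C n) m (move (C n) v start) ≡ SG (P m)
  option≡SG-path = >-weakInduction (λ v → sgBounded (C n) m (move (C n) v start) ≡ SG (P m))
    (sgBounded-image {G = C n} {H = P m} inject₁-injective (C-inject₁ m) last-removed m)
    (λ i next → trans (option-rotation (suc i)) next)

SG-cycle : ∀ j → SG (C (suc (suc (suc j)))) ≡ mex [ SG (P (suc (suc j))) ]
SG-cycle j = mex-cong forward backward
  where
  open CycleOptions j
  forward : ∀ {x} → x ∈ options (C n) m start → x ∈ [ SG (P m) ]
  forward x∈ = let v , _ , x≡option = option⁻ (C n) m start x∈ in
    here (trans x≡option (option≡SG-path v))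
  backward : ∀ {x} → x ∈ [ SG (P m) ] → x ∈ options (C n) m start
  backward (here x≡SG) = subst (_∈ options (C n) m start) (trans (option≡SG-path zero) (sym x≡SG))
    (option⁺ (C n) m start zero (C-initial-live m zero))

-- Paths with an odd number of vertices

suc[m∸1+n]≡m∸n : ∀ {m n} → n < m → suc (m ∸ suc n) ≡ m ∸ n
suc[m∸1+n]≡m∸n {suc m} {zero}  _         = refl
suc[m∸1+n]≡m∸n {suc m} {suc n} (s≤s n<m) = suc[m∸1+n]≡m∸n n<m

odd≢even : ∀ a b → suc (a + a) ≢ b + b
odd≢even zero    zero    ()
odd≢even zero    (suc b) eq with trans (suc-injective eq) (+-suc b b)
... | ()
odd≢even (suc a) (suc b) eq =
  odd≢even a b (suc-injective (trans (cong suc (sym (+-suc a a))) (trans (suc-injective eq) (+-suc b b))))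

double-injective : ∀ {a b} → a + a ≡ b + b → a ≡ b
double-injective {zero}  {zero}  _  = refl
double-injective {suc a} {suc b} eq =
  cong suc (double-injective (suc-injective (trans (sym (+-suc a a)) (trans (suc-injective eq) (+-suc b b)))))

Consecutive : ℕ → ℕ → Set
Consecutive a b = suc a ≡ b ⊎ suc b ≡ a

P-adjacent⁻ : ∀ {m} (u w : Fin m) → T (P m u w) → Consecutive (toℕ u) (toℕ w)
P-adjacent⁻ u w uw = Sum.map (≡ᵇ⇒≡ _ _) (≡ᵇ⇒≡ _ _) (Equivalence.to (T-∨ {suc (toℕ u) ≡ᵇ toℕ w}) uw)

P-adjacent⁺ : ∀ {m} (u w : Fin m) → Consecutive (toℕ u) (toℕ w) → T (P m u w)
P-adjacent⁺ u w consecutive =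
  Equivalence.from (T-∨ {suc (toℕ u) ≡ᵇ toℕ w}) (Sum.map (≡⇒≡ᵇ _ _) (≡⇒≡ᵇ _ _) consecutive)

P-undirected : ∀ m → Undirected (P m)
P-undirected m u w = ∨-comm (suc (toℕ u) ≡ᵇ toℕ w) _

toℕ-opposite+toℕ : ∀ {K} (u : Fin (suc K)) → toℕ (opposite u) + toℕ u ≡ K
toℕ-opposite+toℕ u = trans (cong (_+ toℕ u) (opposite-prop u)) (m∸n+n≡m (≤-pred (toℕ<n u)))

opposite-consecutive : ∀ {K} (u w : Fin (suc K)) →
  suc (toℕ u) ≡ toℕ w → suc (toℕ (opposite w)) ≡ toℕ (opposite u)
opposite-consecutive {K} u w u+1≡w rewrite opposite-prop u | opposite-prop w | sym u+1≡w =
  suc[m∸1+n]≡m∸n (≤-pred (subst (_< suc K) (sym u+1≡w) (toℕ<n w)))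

P-opposite⁺ : ∀ {m} (u w : Fin m) → T (P m u w) → T (P m (opposite u) (opposite w))
P-opposite⁺ {suc K} u w uw with P-adjacent⁻ u w uw
... | inj₁ u+1≡w = P-adjacent⁺ (opposite u) (opposite w) (inj₂ (opposite-consecutive u w u+1≡w))
... | inj₂ w+1≡u = P-adjacent⁺ (opposite u) (opposite w) (inj₁ (opposite-consecutive w u w+1≡u))

P-opposite : ∀ m (u w : Fin m) → P m (opposite u) (opposite w) ≡ P m u w
P-opposite m u w = T-ext backward (P-opposite⁺ u w)
  where
  backward : T (P m (opposite u) (opposite w)) → T (P m u w)
  backward t = subst₂ (λ x y → T (P m x y)) (opposite-involutive u) (opposite-involutive w)
    (P-opposite⁺ (opposite u) (opposite w) t)

P-opposite-nonadjacent : ∀ k (u : Fin (suc (k + k))) → ¬ T (P (suc (k + k)) u (opposite u))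
P-opposite-nonadjacent k u t with P-adjacent⁻ u (opposite u) t
... | inj₁ u+1≡ū = odd≢even (toℕ u) k (begin
  suc (toℕ u + toℕ u)          ≡⟨ cong (_+ toℕ u) u+1≡ū ⟩
  toℕ (opposite u) + toℕ u     ≡⟨ toℕ-opposite+toℕ u ⟩
  k + k                        ∎)
  where open ≡-Reasoning
... | inj₂ ū+1≡u = odd≢even (toℕ (opposite u)) k (begin
  suc (toℕ (opposite u) + toℕ (opposite u))  ≡⟨ sym (+-suc (toℕ (opposite u)) _) ⟩
  toℕ (opposite u) + suc (toℕ (opposite u))  ≡⟨ cong (toℕ (opposite u) +_) ū+1≡u ⟩
  toℕ (opposite u) + toℕ u                   ≡⟨ toℕ-opposite+toℕ u ⟩
  k + k                                      ∎)
  where open ≡-Reasoning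

module OddPath (k : ℕ) where
  K m : ℕ
  K = suc k + suc k
  m = suc K

  half<m : suc k < m
  half<m = s≤s (m≤m+n (suc k) (suc k))

  middle : Fin m
  middle = fromℕ< half<m

  toℕ-middle : toℕ middle ≡ suc k
  toℕ-middle = toℕ-fromℕ< half<m

  opposite-middle : opposite middle ≡ middle
  opposite-middle = toℕ-injective (begin
    toℕ (opposite middle)  ≡⟨ opposite-prop middle ⟩
    K ∸ toℕ middle         ≡⟨ cong (K ∸_) toℕ-middle ⟩
    K ∸ suc k              ≡⟨ m+n∸n≡m (suc k) (suc k) ⟩
    suc k                  ≡⟨ sym toℕ-middle ⟩
    toℕ middle             ∎)
    where open ≡-Reasoning

  opposite-fixed⇒middle : ∀ u → opposite u ≡ u → u ≡ middle
  opposite-fixed⇒middle u ū≡u = toℕ-injective (trans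
    (double-injective (trans (cong (λ x → toℕ x + toℕ u) (sym ū≡u)) (toℕ-opposite+toℕ u)))
    (sym toℕ-middle))

  open MirrorStrategy (P m) (P-undirected m) opposite opposite-involutive (P-opposite m) (P-opposite-nonadjacent (suc k))

  start : VSet m
  start = initial (P m)

  start-live : ∀ u → T (start u)
  start-live u = initial-live (P m) u (P-neighbour (k + suc k) u)

  middle-removed : VSet m
  middle-removed = move (P m) middle start

  start-symmetric : ∀ u → start (opposite u) ≡ start u
  start-symmetric u = T-ext (λ _ → start-live u) (λ _ → start-live (opposite u))

  middle-removed-symmetric : ∀ u → middle-removed (opposite u) ≡ middle-removed u
  middle-removed-symmetric u = begin
    move (P m) middle start (opposite u)
      ≡⟨ cong (λ x → move (P m) x start (opposite u)) (sym opposite-middle) ⟩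
    move (P m) (opposite middle) start (opposite u)
      ≡⟨ IsImageOf.along (σ-move-image (σ-image start-symmetric) middle) u ⟩
    move (P m) middle start u                        ∎
    where open ≡-Reasoning

  middle-removed-isSymmetric : IsSymmetric middle-removed
  middle-removed-isSymmetric = record
    { symmetric = middle-removed-symmetric
    ; fixpoint-free = λ {u} live ū≡u →
        move-removes (P m) middle start (subst (λ x → T (middle-removed x)) (opposite-fixed⇒middle u ū≡u) live)
    ; no-isolated = move-hasNeighbour (P-undirected m) middle start }

  SG-oddPath≢0 : SG (P m) ≢ 0
  SG-oddPath≢0 = mex≢0 (options (P m) K start) (subst (_∈ options (P m) K start)
    (sgBounded-symmetric K middle-removed-isSymmetric
      (≤-pred (≤-trans (size-move (P m) middle start (start-live middle)) (size≤ start))))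
    (option⁺ (P m) K start middle (start-live middle)))

mex[x]≡0 : ∀ x → x ≢ 0 → mex [ x ] ≡ 0
mex[x]≡0 zero    x≢0 = ⊥-elim (x≢0 refl)
mex[x]≡0 (suc x) _   = refl

q*2≡q+q : ∀ q → q * 2 ≡ q + q
q*2≡q+q q = trans (*-comm q 2) (cong (q +_) (+-identityʳ q))

even-cycle⇒SG-path≢0 : ∀ j → 2 ∣ suc (suc (suc j)) → SG (P (suc (suc j))) ≢ 0
even-cycle⇒SG-path≢0 j (divides (suc (suc q)) n≡q*2) =
  subst (λ i → SG (P (suc (suc i))) ≢ 0) (sym j≡q+1+q) (OddPath.SG-oddPath≢0 q)
  where
  open ≡-Reasoning
  j≡q+1+q : j ≡ q + suc q
  j≡q+1+q = begin
    j            ≡⟨ suc-injective (suc-injective (suc-injective n≡q*2)) ⟩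
    1 + q * 2    ≡⟨ cong (1 +_) (q*2≡q+q q) ⟩
    1 + (q + q)  ≡⟨ sym (+-suc q q) ⟩
    q + suc q    ∎

corollary5p5 : (n : ℕ) → 3 ≤ n →
    ((SG (P (n ∸ 1)) ≡ 0 → SG (C n) ≡ 1)
    × (SG (P (n ∸ 1)) ≢ 0 → SG (C n) ≡ 0))
    × (2 ∣ n → SG (C n) ≡ 0)
corollary5p5 (suc zero) (s≤s ())
corollary5p5 (suc (suc zero)) (s≤s (s≤s ()))
corollary5p5 (suc (suc (suc j))) _ = (path-P , path-N) , path-N ∘ even-cycle⇒SG-path≢0 j
  where
  path-P : SG (P (suc (suc j))) ≡ 0 → SG (C (suc (suc (suc j)))) ≡ 1
  -- mex [ 0 ] computes to 1.
  path-P SG≡0 = trans (SG-cycle j) (cong (λ x → mex [ x ]) SG≡0)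

  path-N : SG (P (suc (suc j))) ≢ 0 → SG (C (suc (suc (suc j)))) ≡ 0
  path-N SG≢0 = trans (SG-cycle j) (mex[x]≡0 (SG (P (suc (suc j)))) SG≢0)
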